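{- For infinitely many $\mathbf{a} \in \mathbb{Z}^n$ we have $$\ell(\mathbf{a}) \gg \left(\frac{\log \mathfrak{H}(\mathbf{a})}{\log\log \mathfrak{H}(\mathbf{a})}\right)^{1/n},$$ where the implied constant may depend on $n$.
   Context: For $\mathbf{x} \in \mathbb{Z}^n$, the height is $\mathfrak{H}(\mathbf{x}) = \max\{|x_1|,\ldots,|x_n|\}$. For $\mathbf{a} = (a_1,\ldots,a_n) \in \mathbb{Z}^n$, $\ell(\mathbf{a})$ denotes the smallest $H$ such that there is a vector $\mathbf{h} = (h_1,\ldots,h_n) \in \mathbb{Z}^n$ with $\mathfrak{H}(\mathbf{h}) = H$ and $\gcd(a_1+h_1,\ldots,a_n+h_n) = 1$. The notation $U \gg V$ means $|V| \le c\,U$ for some constant $c>0$. -}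

module Defs where

open import Data.Nat using (ℕ; _≤_; _⊔_)
open import Data.Nat.GCD using (gcd)
open import Data.Integer using (ℤ; ∣_∣; _+_)
open import Data.Vec using (Vec; foldr′; map; zipWith)
open import Data.Product using (Σ; _×_)
open import Relation.Binary.PropositionalEquality using (_≡_)

height : ∀ {n} → Vec ℤ n → ℕ
height x = foldr′ _⊔_ 0 (map ∣_∣ x)

gcdVec : ∀ {n} → Vec ℤ n → ℕ
gcdVec x = foldr′ gcd 0 (map ∣_∣ x)

_⊕_ : ∀ {n} → Vec ℤ n → Vec ℤ n → Vec ℤ n
a ⊕ h = zipWith _+_ a h

IsEll : ∀ {n} → Vec ℤ n → ℕ → Set
IsEll {n} a L =
  Σ (Vec ℤ n) (λ h → height h ≡ L × gcdVec (a ⊕ h) ≡ 1)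
  × ((h : Vec ℤ n) → gcdVec (a ⊕ h) ≡ 1 → L ≤ height h)

{-# OPTIONS --safe #-}
module Submission where

-- Let R = 2^w. Give each of the m = (2R+1)^n shifts h of height at most R its own prime p_h below
-- X = 2^(2u+1), with u ≈ log₂ m; Erdős's central binomial argument (a prime power dividing C(2k, k)
-- is at most 2k) provides enough primes. The Chinese remainder theorem yields a with
-- a_j ≡ -h_j (mod p_h) for all j and h, so every shift of height at most R leaves a common factor
-- and ℓ(a) > R. Reduced into [M, 2M) with M = ∏ p_h, the height H of a has
-- log₂ H ≤ m log₂ X ≪ m log₂ m ≤ m log₂ log₂ H and m ≤ (2ℓ(a))^n.

open import Data.Nat.Base using (ℕ)
open import Data.Nat.Primality using (Prime)

module Arithmetic where

  open import Data.Nat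
  open import Data.Nat.Properties
  open import Data.Nat.Divisibility using (_∣_; divides)
  open import Data.Nat.DivMod using (_/_; _%_; m≡m%n+[m/n]*n; m%n<n)
  open import Data.Nat.Logarithm using (⌊log₂_⌋; ⌊log₂⌋-mono-≤; ⌊log₂[2^n]⌋≡n)
  open import Function using (_∘_)
  open import Relation.Binary.PropositionalEquality
  open import Algebra.Properties.CommutativeSemigroup *-commutativeSemigroup
    using () renaming (interchange to *-interchange)

  ^-monoʳ-∣ : ∀ m {i j} → i ≤ j → m ^ i ∣ m ^ j
  ^-monoʳ-∣ m {i} {j} i≤j = divides (m ^ (j ∸ i))
    (trans (cong (m ^_) (sym (m∸n+n≡m i≤j))) (^-distribˡ-+-* m (j ∸ i) i))

  m≤1+[m/2]+[m/2] : ∀ m → m ≤ suc (m / 2 + m / 2)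
  m≤1+[m/2]+[m/2] m = begin
    m                        ≡⟨ m≡m%n+[m/n]*n m 2 ⟩
    m % 2 + m / 2 * 2        ≤⟨ +-monoˡ-≤ _ (<⇒≤pred (m%n<n m 2)) ⟩
    suc (m / 2 * 2)          ≡⟨ cong suc (*-comm (m / 2) 2) ⟩
    suc (m / 2 + (m / 2 + 0)) ≡⟨ cong (λ t → suc (m / 2 + t)) (+-identityʳ (m / 2)) ⟩
    suc (m / 2 + m / 2)      ∎
    where open ≤-Reasoning

  2^-cancel-≤ : ∀ {m n} → 2 ^ m ≤ 2 ^ n → m ≤ n
  2^-cancel-≤ 2^m≤2^n = ≮⇒≥ λ n<m → <⇒≱ (^-monoʳ-< 2 (s≤s (s≤s z≤n)) n<m) 2^m≤2^n

  1+[n+n]<2^n : ∀ n → 3 ≤ n → suc (n + n) < 2 ^ n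
  1+[n+n]<2^n 0 ()
  1+[n+n]<2^n 1 (s≤s ())
  1+[n+n]<2^n 2 (s≤s (s≤s ()))
  1+[n+n]<2^n 3 _ = s≤s (s≤s (s≤s (s≤s (s≤s (s≤s (s≤s (s≤s z≤n)))))))
  1+[n+n]<2^n (suc n@(suc (suc (suc _)))) _ = begin-strict
    suc (suc n + suc n)   ≡⟨ cong (suc ∘ suc) (+-suc n n) ⟩
    2 + suc (n + n)       <⟨ +-monoʳ-< 2 (1+[n+n]<2^n n (s≤s (s≤s (s≤s z≤n)))) ⟩
    2 + 2 ^ n             ≤⟨ +-monoˡ-≤ (2 ^ n) (^-monoʳ-≤ 2 {1} {n} (s≤s z≤n)) ⟩
    2 ^ n + 2 ^ n         ≡⟨ cong (2 ^ n +_) (+-identityʳ (2 ^ n)) ⟨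
    2 ^ suc n             ∎
    where open ≤-Reasoning

  n<2^n : ∀ n → n < 2 ^ n
  n<2^n zero = s≤s z≤n
  n<2^n (suc n) = begin-strict
    suc n          <⟨ s≤s (n<2^n n) ⟩
    suc (2 ^ n)    ≤⟨ +-monoˡ-≤ (2 ^ n) (m^n>0 2 n) ⟩
    2 ^ n + 2 ^ n  ≡⟨ cong (2 ^ n +_) (+-identityʳ (2 ^ n)) ⟨
    2 ^ suc n      ∎
    where open ≤-Reasoning

  [m*n]^o≡m^o*n^o : ∀ m n o → (m * n) ^ o ≡ m ^ o * n ^ o
  [m*n]^o≡m^o*n^o m n zero = refl
  [m*n]^o≡m^o*n^o m n (suc o) = trans (cong ((m * n) *_) ([m*n]^o≡m^o*n^o m n o)) (*-interchange m n (m ^ o) (n ^ o))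

  log₂-ratio : ∀ {H m c T} → c ≤ 12 * T → 2 ^ T ≤ m → 2 ^ m ≤ H → H ≤ 2 ^ (c * m) →
               ⌊log₂ H ⌋ ≤ 12 * m * ⌊log₂ ⌊log₂ H ⌋ ⌋
  log₂-ratio {H} {m} {c} {T} c≤12T 2^T≤m 2^m≤H H≤2^cm = begin
    ⌊log₂ H ⌋                 ≤⟨ ⌊log₂⌋-mono-≤ H≤2^cm ⟩
    ⌊log₂ (2 ^ (c * m)) ⌋     ≡⟨ ⌊log₂[2^n]⌋≡n (c * m) ⟩
    c * m                     ≤⟨ *-monoˡ-≤ m c≤12T ⟩
    12 * T * m                ≡⟨ *-assoc 12 T m ⟩
    12 * (T * m)              ≡⟨ cong (12 *_) (*-comm T m) ⟩
    12 * (m * T)              ≡⟨ *-assoc 12 m T ⟨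
    12 * m * T                ≤⟨ *-monoʳ-≤ (12 * m) T≤ ⟩
    12 * m * ⌊log₂ ⌊log₂ H ⌋ ⌋ ∎
    where
    open ≤-Reasoning
    2^k≤n⇒k≤⌊log₂n⌋ : ∀ {k n} → 2 ^ k ≤ n → k ≤ ⌊log₂ n ⌋
    2^k≤n⇒k≤⌊log₂n⌋ {k} 2^k≤n = subst (_≤ _) (⌊log₂[2^n]⌋≡n k) (⌊log₂⌋-mono-≤ 2^k≤n)
    T≤ : T ≤ ⌊log₂ ⌊log₂ H ⌋ ⌋
    T≤ = 2^k≤n⇒k≤⌊log₂n⌋ (≤-trans 2^T≤m (2^k≤n⇒k≤⌊log₂n⌋ 2^m≤H))

module CentralBinomial where

  open import Data.Nat
  open import Data.Nat.Properties
  open import Data.Nat.DivMod using (_/_; m/n*n≡m)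
  open import Data.Nat.Combinatorics using (k![n∸k]!∣n!)
  open import Data.Nat.Divisibility using (_∣_)
  open import Data.Nat.Tactic.RingSolver using (solve-∀)
  open import Relation.Binary.PropositionalEquality

  centralBinomial : ℕ → ℕ
  centralBinomial k = ((k + k) ! / (k ! * k !)) {{k !* k !≢0}}

  centralBinomial*k!*k!≡[2k]! : ∀ k → centralBinomial k * (k ! * k !) ≡ (k + k) !
  centralBinomial*k!*k!≡[2k]! k = m/n*n≡m {{k !* k !≢0}}
    (subst (λ t → k ! * t ! ∣ (k + k) !) (m+n∸m≡n k k) (k![n∸k]!∣n! (m≤m+n k k)))

  2^k*k!*k!≤[2k]! : ∀ k → 2 ^ k * (k ! * k !) ≤ (k + k) !
  2^k*k!*k!≤[2k]! zero = ≤-refl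
  2^k*k!*k!≤[2k]! (suc k) = begin
    2 ^ suc k * (suc k ! * suc k !)                     ≡⟨ regroup (2 ^ k) k (k !) ⟩
    ((suc k + suc k) * suc k) * (2 ^ k * (k ! * k !))  ≤⟨ *-mono-≤ (*-monoʳ-≤ (suc k + suc k) (s≤s (m≤m+n k k))) (2^k*k!*k!≤[2k]! k) ⟩
    ((suc k + suc k) * suc (k + k)) * (k + k) !         ≡⟨ *-assoc (suc k + suc k) (suc (k + k)) ((k + k) !) ⟩
    (suc k + suc k) * (suc (k + k) * (k + k) !)         ≡⟨ cong (λ t → (suc k + suc k) * t !) (+-suc k k) ⟨
    (suc k + suc k) !                                   ∎
    where
    open ≤-Reasoning
    regroup : ∀ t k f → (2 * t) * ((suc k * f) * (suc k * f)) ≡ ((suc k + suc k) * suc k) * (t * (f * f))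
    regroup = solve-∀

  2^k≤centralBinomial : ∀ k → 2 ^ k ≤ centralBinomial k
  2^k≤centralBinomial k = *-cancelʳ-≤ (2 ^ k) (centralBinomial k) (k ! * k !) {{k !* k !≢0}}
    (subst (2 ^ k * (k ! * k !) ≤_) (sym (centralBinomial*k!*k!≡[2k]! k)) (2^k*k!*k!≤[2k]! k))

  centralBinomial≢0 : ∀ k → NonZero (centralBinomial k)
  centralBinomial≢0 k = >-nonZero (≤-trans (m^n>0 2 k) (2^k≤centralBinomial k))

module Valuation {p : ℕ} (p-prime : Prime p) where

  open import Data.Nat
  open import Data.Nat.Properties
  open import Data.Nat.Divisibility
  open import Data.Nat.DivMod
  open import Data.Nat.Primality using (Prime; prime⇒nonZero; prime⇒nonTrivial; euclidsLemma)
  open import Data.Nat.Induction using (<-rec)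
  open import Data.Product using (∃; ∃₂; _×_; _,_; proj₁; proj₂)
  open import Data.Sum using (inj₁; inj₂)
  open import Relation.Nullary using (¬_; yes; no; contradiction)
  open import Relation.Binary.PropositionalEquality
  open import Algebra.Properties.CommutativeSemigroup *-commutativeSemigroup
    using () renaming (interchange to *-interchange)
  open import Algebra.Properties.CommutativeSemigroup +-commutativeSemigroup
    using () renaming (interchange to +-interchange; x∙yz≈y∙xz to +-x∙yz≈y∙xz)
  open Arithmetic
  open CentralBinomial

  private instance
    p≢0 : NonZero p
    p≢0 = prime⇒nonZero p-prime

  1<p : 1 < p
  1<p = nonTrivial⇒n>1 p {{prime⇒nonTrivial p-prime}}

  PowerSplit : ℕ → Set
  PowerSplit n = ∃₂ λ e m → ¬ p ∣ m × n ≡ p ^ e * m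

  powerSplit : ∀ n → .{{NonZero n}} → PowerSplit n
  powerSplit = <-rec _ go
    where
    go : ∀ n → (∀ {k} → k < n → .{{NonZero k}} → PowerSplit k) → .{{NonZero n}} → PowerSplit n
    go (suc n) rec with p ∣? suc n
    ... | no p∤n = 0 , suc n , p∤n , sym (*-identityˡ (suc n))
    ... | yes (divides k@(suc _) n≡k*p) with rec (subst (k <_) (sym n≡k*p) (m<m*n k p 1<p))
    ...   | e , m , p∤m , k≡ = suc e , m , p∤m , (begin
      suc n          ≡⟨ n≡k*p ⟩
      k * p          ≡⟨ *-comm k p ⟩
      p * k          ≡⟨ cong (p *_) k≡ ⟩
      p * (p ^ e * m) ≡⟨ *-assoc p (p ^ e) m ⟨
      p ^ suc e * m  ∎)
      where open ≡-Reasoning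

  exponent-unique : ∀ {e e′ m m′} → ¬ p ∣ m → ¬ p ∣ m′ → p ^ e * m ≡ p ^ e′ * m′ → e ≡ e′
  exponent-unique {zero} {zero} _ _ _ = refl
  exponent-unique {zero} {suc e′} {m} {m′} p∤m _ eq =
    contradiction (divides (p ^ e′ * m′) (trans (trans (sym (*-identityˡ m)) eq) (trans (*-assoc p _ m′) (*-comm p _)))) p∤m
  exponent-unique {suc e} {zero} p∤m p∤m′ eq = sym (exponent-unique p∤m′ p∤m (sym eq))
  exponent-unique {suc e} {suc e′} {m} {m′} p∤m p∤m′ eq =
    cong suc (exponent-unique p∤m p∤m′ (*-cancelˡ-≡ _ _ p (trans (sym (*-assoc p _ m)) (trans eq (*-assoc p _ m′)))))

  private instance
    p*≢0 : ∀ {a} .{{_ : NonZero a}} → NonZero (p * a)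
    p*≢0 {a} = m*n≢0 p a

  v : ∀ n → .{{NonZero n}} → ℕ
  v n = proj₁ (powerSplit n)

  v-split : ∀ n .{{_ : NonZero n}} → ∃ λ m → ¬ p ∣ m × n ≡ p ^ v n * m
  v-split n = proj₂ (powerSplit n)

  v-cong : ∀ {m n} .{{_ : NonZero m}} .{{_ : NonZero n}} → m ≡ n → v m ≡ v n
  v-cong refl = refl

  v-unique : ∀ n .{{_ : NonZero n}} {e m} → ¬ p ∣ m → n ≡ p ^ e * m → v n ≡ e
  v-unique n p∤m n≡ with v-split n
  ... | _ , p∤m′ , n≡′ = exponent-unique p∤m′ p∤m (trans (sym n≡′) n≡)

  v-∤ : ∀ n .{{_ : NonZero n}} → ¬ p ∣ n → v n ≡ 0
  v-∤ n p∤n = v-unique n p∤n (sym (*-identityˡ n))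

  v-p* : ∀ a .{{_ : NonZero a}} → v (p * a) ≡ suc (v a)
  v-p* a with v-split a
  ... | m , p∤m , a≡ = v-unique (p * a) p∤m (trans (cong (p *_) a≡) (sym (*-assoc p _ m)))

  v-* : ∀ a b .{{_ : NonZero a}} .{{_ : NonZero b}} → v (a * b) {{m*n≢0 a b}} ≡ v a + v b
  v-* a b with v-split a | v-split b
  ... | m , p∤m , a≡ | m′ , p∤m′ , b≡ = v-unique (a * b) {{m*n≢0 a b}} p∤mm′ (begin
      a * b                           ≡⟨ cong₂ _*_ a≡ b≡ ⟩
      (p ^ v a * m) * (p ^ v b * m′)  ≡⟨ *-interchange (p ^ v a) m (p ^ v b) m′ ⟩
      (p ^ v a * p ^ v b) * (m * m′)  ≡⟨ cong (_* (m * m′)) (^-distribˡ-+-* p (v a) (v b)) ⟨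
      p ^ (v a + v b) * (m * m′)      ∎)
    where
    open ≡-Reasoning
    p∤mm′ : ¬ p ∣ m * m′
    p∤mm′ p∣mm′ with euclidsLemma m m′ p-prime p∣mm′
    ... | inj₁ p∣m = p∤m p∣m
    ... | inj₂ p∣m′ = p∤m′ p∣m′

  p^v∣n : ∀ n .{{_ : NonZero n}} → p ^ v n ∣ n
  p^v∣n n with v-split n
  ... | m , _ , n≡ = divides m (trans n≡ (*-comm (p ^ v n) m))

  p^e∣n⇒e≤v : ∀ n .{{_ : NonZero n}} {e} → p ^ e ∣ n → e ≤ v n
  p^e∣n⇒e≤v n {e} p^e∣n with v-split n | e ≤? v n
  ... | _ | yes e≤v = e≤v
  ... | m , p∤m , n≡ | no e≰v = contradiction (*-cancelˡ-∣ (p ^ v n) {{m^n≢0 p (v n)}} p^v*p∣p^v*m) p∤m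
    where
    p^v*p∣p^v*m : p ^ v n * p ∣ p ^ v n * m
    p^v*p∣p^v*m = subst₂ _∣_ (*-comm p (p ^ v n)) n≡ (∣-trans (^-monoʳ-∣ p (≰⇒> e≰v)) p^e∣n)

  v[1]≡0 : v 1 ≡ 0
  v[1]≡0 = v-∤ 1 (λ p∣1 → <⇒≢ 1<p (sym (∣1⇒≡1 p∣1)))

  v! : ℕ → ℕ
  v! n = v (n !) {{n !≢0}}

  v![1+n] : ∀ n → v! (suc n) ≡ v (suc n) + v! n
  v![1+n] n = v-* (suc n) (n !) {{_}} {{n !≢0}}

  p∤pa+r : ∀ a r → 0 < r → r < p → ¬ p ∣ p * a + r
  p∤pa+r a r 0<r r<p p∣pa+r = <⇒≱ r<p (∣⇒≤ {{>-nonZero 0<r}} (∣m+n∣m⇒∣n p∣pa+r (m∣m*n a)))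

  legendre : ∀ a r → r < p → v! (p * a + r) ≡ a + v! a
  legendre zero zero _ = cong (λ t → v! (t + 0)) (*-zeroʳ p)
  legendre (suc a) zero _ = begin
      v! (p * suc a + 0)               ≡⟨ cong v! pa+p≡ ⟩
      v! (suc (p * a + pred p))        ≡⟨ v![1+n] (p * a + pred p) ⟩
      v (suc (p * a + pred p)) + v! (p * a + pred p)
                                       ≡⟨ cong₂ _+_ (trans (v-cong (sym pa+p≡′)) (v-p* (suc a))) (legendre a (pred p) pred[p]<p) ⟩
      suc (v (suc a)) + (a + v! a)     ≡⟨ cong suc (+-x∙yz≈y∙xz (v (suc a)) a (v! a)) ⟩
      suc a + (v (suc a) + v! a)       ≡⟨ cong (suc a +_) (v![1+n] a) ⟨
      suc a + v! (suc a)               ∎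
    where
    open ≡-Reasoning
    pred[p]<p : pred p < p
    pred[p]<p = ≤-reflexive (suc-pred p)
    pa+p≡′ : p * suc a ≡ suc (p * a + pred p)
    pa+p≡′ = trans (*-suc p a) (trans (cong (_+ p * a) (sym (suc-pred p))) (cong suc (+-comm (pred p) (p * a))))
    pa+p≡ : p * suc a + 0 ≡ suc (p * a + pred p)
    pa+p≡ = trans (+-identityʳ _) pa+p≡′
  legendre a (suc r) r<p = begin
      v! (p * a + suc r)                  ≡⟨ cong v! (+-suc (p * a) r) ⟩
      v! (suc (p * a + r))                ≡⟨ v![1+n] (p * a + r) ⟩
      v (suc (p * a + r)) + v! (p * a + r) ≡⟨ cong₂ _+_ v[pa+1+r]≡0 (legendre a r (<-trans (n<1+n r) r<p)) ⟩
      a + v! a                            ∎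
    where
    open ≡-Reasoning
    v[pa+1+r]≡0 : v (suc (p * a + r)) ≡ 0
    v[pa+1+r]≡0 = v-∤ _ (subst (λ t → ¬ p ∣ t) (+-suc (p * a) r) (p∤pa+r a (suc r) z<s r<p))

  legendre/ : ∀ n → v! n ≡ n / p + v! (n / p)
  legendre/ n = trans (cong v! n≡) (legendre (n / p) (n % p) (m%n<n n p))
    where
    n≡ : n ≡ p * (n / p) + n % p
    n≡ = trans (m≡m%n+[m/n]*n n p) (trans (+-comm (n % p) _) (cong (_+ n % p) (*-comm (n / p) p)))

  -- For n = 2k this is p ^ v(C(2k, k)) ≤ 2k; stated for all n so that it follows by induction on n / p.
  p^v![n]≤n*p^2v![n/2] : ∀ n .{{_ : NonZero n}} → p ^ v! n ≤ n * p ^ (v! (n / 2) + v! (n / 2))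
  p^v![n]≤n*p^2v![n/2] = <-rec _ go
    where
    Goal : ℕ → Set
    Goal n = .{{_ : NonZero n}} → p ^ v! n ≤ n * p ^ (v! (n / 2) + v! (n / 2))
    go : ∀ n → (∀ {k} → k < n → Goal k) → Goal n
    go n rec with n / p ≟ 0
    ... | yes q≡0 = begin
      p ^ v! n                      ≡⟨ cong (p ^_) (trans (legendre/ n) (cong (λ q → q + v! q) q≡0)) ⟩
      p ^ v 1                       ≡⟨ cong (p ^_) v[1]≡0 ⟩
      1                             ≤⟨ *-mono-≤ (>-nonZero⁻¹ n) (m^n>0 p (v! (n / 2) + v! (n / 2))) ⟩
      n * p ^ (v! (n / 2) + v! (n / 2)) ∎
      where open ≤-Reasoning
    ... | no q≢0 = begin
      p ^ v! n                                     ≡⟨ cong (p ^_) (legendre/ n) ⟩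
      p ^ (q + v! q)                               ≡⟨ ^-distribˡ-+-* p q _ ⟩
      p ^ q * p ^ v! q                             ≤⟨ *-mono-≤ (^-monoʳ-≤ p (m≤1+[m/2]+[m/2] q)) (rec (m/n<m n p 1<p) {{≢-nonZero q≢0}}) ⟩
      p ^ suc (h′ + h′) * (q * p ^ (x + x))        ≡⟨ regroup h′ x ⟩
      (p * q) * p ^ ((h′ + x) + (h′ + x))          ≤⟨ *-monoˡ-≤ _ (subst (_≤ n) (*-comm q p) (m/n*n≤m n p)) ⟩
      n * p ^ ((h′ + x) + (h′ + x))                ≡⟨ cong (λ y → n * p ^ (y + y)) v![h]≡ ⟨
      n * p ^ (v! (n / 2) + v! (n / 2))            ∎
      where
      open ≤-Reasoning
      q h′ x : ℕ
      q = n / p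
      h′ = q / 2
      x = v! h′
      v![h]≡ : v! (n / 2) ≡ h′ + x
      v![h]≡ = trans (legendre/ (n / 2)) (cong (λ t → t + v! t) n/2/p≡n/p/2)
        where
        n/2/p≡n/p/2 : n / 2 / p ≡ n / p / 2
        n/2/p≡n/p/2 = trans (m/n/o≡m/[n*o] n 2 p {{_}} {{_}} {{m*n≢0 2 p}})
          (trans (/-congʳ {{m*n≢0 2 p}} {{m*n≢0 p 2}} (*-comm 2 p)) (sym (m/n/o≡m/[n*o] n p 2)))
      regroup : ∀ y z → p ^ suc (y + y) * (q * p ^ (z + z)) ≡ (p * q) * p ^ ((y + z) + (y + z))
      regroup y z = trans (*-interchange p (p ^ (y + y)) q (p ^ (z + z)))
        (cong ((p * q) *_) (trans (sym (^-distribˡ-+-* p (y + y) (z + z)))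
          (cong (p ^_) (+-interchange y y z z))))

  p^e∣centralBinomial⇒p^e≤2k : ∀ k .{{_ : NonZero k}} {e} → p ^ e ∣ centralBinomial k → p ^ e ≤ k + k
  p^e∣centralBinomial⇒p^e≤2k k {e} p^e∣C = ≤-trans (^-monoʳ-≤ p {e} {v C} (p^e∣n⇒e≤v C p^e∣C)) p^v[C]≤2k
    where
    C y : ℕ
    C = centralBinomial k
    y = v! k + v! k
    instance
      C≢0 : NonZero C
      C≢0 = centralBinomial≢0 k
    C*k!k!≢0 : NonZero (C * (k ! * k !))
    C*k!k!≢0 = m*n≢0 C (k ! * k !) {{C≢0}} {{k !* k !≢0}}
    v![2k]≡ : v! (k + k) ≡ v C + y
    v![2k]≡ = begin
      v! (k + k)                          ≡⟨ v-cong {{_}} {{C*k!k!≢0}} (sym (centralBinomial*k!*k!≡[2k]! k)) ⟩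
      v (C * (k ! * k !)) {{C*k!k!≢0}}    ≡⟨ v-* C (k ! * k !) {{_}} {{k !* k !≢0}} ⟩
      v C + v (k ! * k !) {{k !* k !≢0}}  ≡⟨ cong (v C +_) (v-* (k !) (k !) {{k !≢0}} {{k !≢0}}) ⟩
      v C + y                             ∎
      where open ≡-Reasoning
    [2k]/2≡k : (k + k) / 2 ≡ k
    [2k]/2≡k = trans (cong (_/ 2) (cong (k +_) (sym (+-identityʳ k)))) (trans (cong (_/ 2) (*-comm 2 k)) (m*n/n≡m k 2))
    p^v[C]≤2k : p ^ v C ≤ k + k
    p^v[C]≤2k = *-cancelʳ-≤ (p ^ v C) (k + k) (p ^ y) {{m^n≢0 p y}} (begin
      p ^ v C * p ^ y      ≡⟨ ^-distribˡ-+-* p (v C) y ⟨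
      p ^ (v C + y)        ≡⟨ cong (p ^_) v![2k]≡ ⟨
      p ^ v! (k + k)       ≤⟨ p^v![n]≤n*p^2v![n/2] (k + k) {{>-nonZero (≤-trans (>-nonZero⁻¹ k) (m≤m+n k k))}} ⟩
      (k + k) * p ^ (v! ((k + k) / 2) + v! ((k + k) / 2)) ≡⟨ cong (λ t → (k + k) * p ^ (v! t + v! t)) [2k]/2≡k ⟩
      (k + k) * p ^ y      ∎)
      where open ≤-Reasoning

module PrimeCounting where

  open import Data.Nat
  open import Data.Nat.Properties
  open import Data.Nat.Divisibility
  open import Data.Nat.Primality using (Prime; prime?)
  open import Data.Nat.Primality.Factorisation using (factorise)
  open import Data.Nat.ListAction using (product)
  open import Data.List using (List; []; _∷_; length; filter; upTo)
  open import Data.List.Membership.Propositional using (_∈_)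
  open import Data.List.Membership.Propositional.Properties using (∈-filter⁺; ∈-filter⁻; ∈-upTo⁺; ∈-upTo⁻)
  open import Data.List.Relation.Unary.All as All using (All; []; _∷_)
  open import Data.List.Relation.Unary.All.Properties using (all-filter)
  open import Data.List.Relation.Unary.Any using (here; there)
  open import Data.List.Relation.Unary.Unique.Propositional using (Unique)
  import Data.List.Relation.Unary.Unique.Propositional.Properties as Unique
  open import Data.Product using (_,_; proj₁)
  open import Relation.Nullary using (yes; no; contradiction)
  open import Relation.Binary.PropositionalEquality
  open Arithmetic
  open CentralBinomial

  primesUpTo : ℕ → List ℕ
  primesUpTo x = filter prime? (upTo (suc x))

  primesUpTo-prime : ∀ x → All Prime (primesUpTo x)
  primesUpTo-prime x = all-filter prime? (upTo (suc x))

  primesUpTo-≤ : ∀ x → All (_≤ x) (primesUpTo x)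
  primesUpTo-≤ x = All.tabulate (λ q∈ → ≤-pred (∈-upTo⁻ (proj₁ (∈-filter⁻ prime? q∈))))

  primesUpTo-unique : ∀ x → Unique (primesUpTo x)
  primesUpTo-unique x = Unique.filter⁺ prime? (Unique.upTo⁺ (suc x))

  primesUpTo-complete : ∀ {x q} → Prime q → q ≤ x → q ∈ primesUpTo x
  primesUpTo-complete q-prime q≤x = ∈-filter⁺ prime? (∈-upTo⁺ (s≤s q≤x)) q-prime

  n≤M^|S| : ∀ (S : List ℕ) → All Prime S → ∀ n M .{{_ : NonZero n}} →
            (∀ {q} → Prime q → q ∣ n → q ∈ S) →
            (∀ {q} e → Prime q → q ^ e ∣ n → q ^ e ≤ M) →
            n ≤ M ^ length S
  n≤M^|S| [] [] n M support _ with factorise n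
  ... | record { factors = [] ; isFactorisation = n≡1 } = ≤-reflexive n≡1
  ... | record { factors = q ∷ qs ; isFactorisation = n≡ ; factorsPrime = q-prime ∷ _ } =
    contradiction (support q-prime (divides (product qs) (trans n≡ (*-comm q _)))) λ ()
  n≤M^|S| (q ∷ S) (q-prime ∷ S-prime) n M support bounded with Valuation.v-split q-prime n
  ... | m , q∤m , n≡ = begin
    n                ≡⟨ n≡ ⟩
    q ^ v n * m      ≤⟨ *-mono-≤ (bounded (v n) q-prime (p^v∣n n)) (n≤M^|S| S S-prime m M {{m≢0}} support′ bounded′) ⟩
    M * M ^ length S ∎
    where
    open ≤-Reasoning
    open Valuation q-prime
    m∣n : m ∣ n
    m∣n = divides (q ^ v n) n≡
    m≢0 : NonZero m
    m≢0 = ≢-nonZero λ { refl → q∤m (q ∣0) }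
    support′ : ∀ {r} → Prime r → r ∣ m → r ∈ S
    support′ r-prime r∣m with support r-prime (∣-trans r∣m m∣n)
    ... | here refl = contradiction r∣m q∤m
    ... | there r∈S = r∈S
    bounded′ : ∀ {r} e → Prime r → r ^ e ∣ m → r ^ e ≤ M
    bounded′ e r-prime r^e∣m = bounded e r-prime (∣-trans r^e∣m m∣n)

  2^k≤[2k]^π[2k] : ∀ k .{{_ : NonZero k}} → 2 ^ k ≤ (k + k) ^ length (primesUpTo (k + k))
  2^k≤[2k]^π[2k] k = ≤-trans (2^k≤centralBinomial k)
    (n≤M^|S| (primesUpTo (k + k)) (primesUpTo-prime (k + k)) (centralBinomial k) (k + k) {{centralBinomial≢0 k}} support bounded)
    where
    bounded : ∀ {q} e → Prime q → q ^ e ∣ centralBinomial k → q ^ e ≤ k + k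
    bounded e q-prime = Valuation.p^e∣centralBinomial⇒p^e≤2k q-prime k {e}
    support : ∀ {q} → Prime q → q ∣ centralBinomial k → q ∈ primesUpTo (k + k)
    support {q} q-prime q∣C = primesUpTo-complete q-prime
      (subst (_≤ k + k) (*-identityʳ q) (bounded 1 q-prime (subst (_∣ centralBinomial k) (sym (*-identityʳ q)) q∣C)))

  2^u≤π[2^[1+2u]] : ∀ u → 3 ≤ u → 2 ^ u ≤ length (primesUpTo (2 ^ suc (u + u)))
  2^u≤π[2^[1+2u]] u 3≤u with 2 ^ u ≤? length (primesUpTo (2 ^ suc (u + u)))
  ... | yes enough = enough
  ... | no too-few = contradiction 2^u≤1+2u (<⇒≱ (1+[n+n]<2^n u 3≤u))
    where
    k X π : ℕ
    k = 2 ^ (u + u)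
    X = 2 ^ suc (u + u)
    π = length (primesUpTo X)
    2^k≤ : 2 ^ k ≤ 2 ^ (suc (u + u) * 2 ^ u)
    2^k≤ = begin
      2 ^ k                                    ≤⟨ 2^k≤[2k]^π[2k] k {{m^n≢0 2 (u + u)}} ⟩
      (k + k) ^ length (primesUpTo (k + k))    ≡⟨ cong (λ x → x ^ length (primesUpTo x)) (cong (k +_) (sym (+-identityʳ k))) ⟩
      X ^ π                                    ≤⟨ ^-monoʳ-≤ X {{m^n≢0 2 (suc (u + u))}} (<⇒≤ (≰⇒> too-few)) ⟩
      X ^ 2 ^ u                                ≡⟨ ^-*-assoc 2 (suc (u + u)) (2 ^ u) ⟩
      2 ^ (suc (u + u) * 2 ^ u)                ∎
      where open ≤-Reasoning
    2^u≤1+2u : 2 ^ u ≤ suc (u + u)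
    2^u≤1+2u = *-cancelʳ-≤ (2 ^ u) (suc (u + u)) (2 ^ u) {{m^n≢0 2 u}}
      (subst (_≤ suc (u + u) * 2 ^ u) (^-distribˡ-+-* 2 u u) (2^-cancel-≤ 2^k≤))

module ChineseRemainder where

  open import Data.Nat as ℕ using (ℕ)
  open import Data.Nat.Divisibility as ℕ using () renaming (_∣_ to _∣ₙ_)
  open import Data.Nat.GCD using (module Bézout)
  open import Data.Nat.Coprimality using (Coprime; coprime-Bézout)
  open import Data.Nat.Primality using (Prime; prime⇒irreducible)
  open import Data.Nat.Primality.Factorisation using (factorisationHasAllPrimeFactors)
  open import Data.Nat.ListAction using (product)
  open import Data.Integer using (ℤ; +_; _+_; _-_; _*_; -_; 0ℤ; 1ℤ; _%ℕ_; _/ℕ_)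
  open import Data.Integer.Properties using (pos-+)
  open import Data.Integer.DivMod using (a≡a%ℕn+[a/ℕn]*n)
  open import Data.Integer.Divisibility.Signed
  open import Data.Integer.Tactic.RingSolver using (solve-∀)
  open import Data.List using (List; []; _∷_; map)
  open import Data.List.Relation.Unary.All as All using (All; []; _∷_)
  open import Data.List.Relation.Unary.Unique.Propositional using (Unique)
  open import Data.List.Relation.Unary.AllPairs using (_∷_)
  open import Data.Product using (∃; _×_; _,_; proj₂)
  open import Data.Sum using (inj₁; inj₂)
  open import Relation.Nullary using (¬_; contradiction)
  open import Relation.Binary.PropositionalEquality

  prime∤⇒coprime : ∀ {p m} → Prime p → ¬ p ∣ₙ m → Coprime p m
  prime∤⇒coprime p-prime p∤m (d∣p , d∣m) with prime⇒irreducible p-prime d∣p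
  ... | inj₁ d≡1 = d≡1
  ... | inj₂ refl = contradiction d∣m p∤m

  coprime⇒separator : ∀ {p m} → Coprime p m → ∃ λ A → + p ∣ A × + m ∣ 1ℤ - A
  coprime⇒separator {p} {m} p⊥m with coprime-Bézout p⊥m
  ... | Bézout.+- x y 1+ym≡xp = + (x ℕ.* p) , ∣ᵤ⇒∣ (ℕ.divides x refl) ,
    subst (+ m ∣_) (sym 1-xp≡-ym) (∣m⇒∣-m (∣ᵤ⇒∣ (ℕ.divides y refl)))
    where
    1-[1+Y]≡-Y : ∀ Y → 1ℤ - (1ℤ + Y) ≡ - Y
    1-[1+Y]≡-Y = solve-∀
    1-xp≡-ym : 1ℤ - + (x ℕ.* p) ≡ - + (y ℕ.* m)
    1-xp≡-ym = trans (cong (λ t → 1ℤ - t) (sym (cong +_ 1+ym≡xp))) (1-[1+Y]≡-Y (+ (y ℕ.* m)))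
  ... | Bézout.-+ x y 1+xp≡ym = - + (x ℕ.* p) , ∣m⇒∣-m (∣ᵤ⇒∣ (ℕ.divides x refl)) ,
    subst (+ m ∣_) (sym 1+xp≡) (∣ᵤ⇒∣ (ℕ.divides y refl))
    where
    1-[-X]≡1+X : ∀ X → 1ℤ - (- X) ≡ 1ℤ + X
    1-[-X]≡1+X = solve-∀
    1+xp≡ : 1ℤ - (- + (x ℕ.* p)) ≡ + (y ℕ.* m)
    1+xp≡ = trans (1-[-X]≡1+X (+ (x ℕ.* p))) (cong +_ 1+xp≡ym)

  prime∤product : ∀ {p qs} → Prime p → All Prime qs → All (p ≢_) qs → ¬ p ∣ₙ product qs
  prime∤product p-prime qs-prime p∉qs p∣∏qs =
    All.lookup p∉qs (factorisationHasAllPrimeFactors p-prime p∣∏qs qs-prime) refl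

  M∣[y%M+M]-y : ∀ y M .{{_ : ℕ.NonZero M}} → + M ∣ + (y %ℕ M ℕ.+ M) - y
  M∣[y%M+M]-y y M = subst (+ M ∣_) (sym [y%M+M]-y≡) (∣n⇒∣m*n (1ℤ - y /ℕ M) ∣-refl)
    where
    [r+M]-[r+qM]≡[1-q]M : ∀ r M q → (r + M) - (r + q * M) ≡ (1ℤ - q) * M
    [r+M]-[r+qM]≡[1-q]M = solve-∀
    [y%M+M]-y≡ : + (y %ℕ M ℕ.+ M) - y ≡ (1ℤ - y /ℕ M) * + M
    [y%M+M]-y≡ = trans (cong₂ _-_ (pos-+ (y %ℕ M) M) (a≡a%ℕn+[a/ℕn]*n y M))
      ([r+M]-[r+qM]≡[1-q]M (+ (y %ℕ M)) (+ M) (y /ℕ M))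

  module _ {X : Set} (residue : X → ℤ) where

    ∣product : ∀ (L : List (X × ℕ)) → All (λ (_ , q) → q ∣ₙ product (map proj₂ L)) L
    ∣product [] = []
    ∣product ((_ , p) ∷ L) = ℕ.m∣m*n (product (map proj₂ L)) ∷ All.map (λ q∣M → ℕ.∣-trans q∣M (ℕ.n∣m*n p)) (∣product L)

    chineseRemainder : ∀ (L : List (X × ℕ)) → All Prime (map proj₂ L) → Unique (map proj₂ L) →
                       ∃ λ y → All (λ (x , q) → + q ∣ y - residue x) L
    chineseRemainder [] _ _ = 0ℤ , []
    chineseRemainder ((x , p) ∷ L) (p-prime ∷ L-prime) (p∉L ∷ L-unique)
      with chineseRemainder L L-prime L-unique
         | coprime⇒separator (prime∤⇒coprime p-prime (prime∤product p-prime L-prime p∉L))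
    ... | y′ , y′≡rs | A , p∣A , M∣1-A = y , y≡r ∷ y≡rs
      where
      r : ℤ
      r = residue x
      y : ℤ
      y = y′ * A + r * (1ℤ - A)
      y-r≡ : ∀ y′ A r → (y′ * A + r * (1ℤ - A)) - r ≡ (y′ - r) * A
      y-r≡ = solve-∀
      y-rᵢ≡ : ∀ y′ A r rᵢ → (y′ * A + r * (1ℤ - A)) - rᵢ ≡ (r - y′) * (1ℤ - A) + (y′ - rᵢ)
      y-rᵢ≡ = solve-∀
      y≡r : + p ∣ y - r
      y≡r = subst (+ p ∣_) (sym (y-r≡ y′ A r)) (∣n⇒∣m*n (y′ - r) p∣A)
      y≡rs : All (λ (xᵢ , q) → + q ∣ y - residue xᵢ) L
      y≡rs = All.zipWith (λ { {xᵢ , q} (q∣M , q∣y′-rᵢ) → subst (+ q ∣_) (sym (y-rᵢ≡ y′ A r (residue xᵢ)))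
               (∣m∣n⇒∣m+n (∣n⇒∣m*n (r - y′) (∣-trans (∣ᵤ⇒∣ q∣M) M∣1-A)) q∣y′-rᵢ) })
             (∣product L , y′≡rs)

module Lists where

  open import Data.Nat
  open import Data.Nat.Properties
  open import Data.Nat.ListAction using (product)
  open import Data.List using (List; []; _∷_; length; map; zip; take; cartesianProductWith)
  open import Data.List.Properties using (length-map; length-++)
  open import Data.List.Membership.Propositional using (_∈_)
  open import Data.List.Relation.Unary.All using (All; []; _∷_)
  open import Data.List.Relation.Unary.Any using (here; there)
  open import Data.Product using (∃; _,_; proj₂)
  open import Relation.Binary.PropositionalEquality

  product≤^length : ∀ {c} xs → All (_≤ c) xs → product xs ≤ c ^ length xs
  product≤^length [] [] = ≤-refl
  product≤^length (_ ∷ xs) (x≤c ∷ xs≤c) = *-mono-≤ x≤c (product≤^length xs xs≤c)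

  2^length≤product : ∀ xs → All (2 ≤_) xs → 2 ^ length xs ≤ product xs
  2^length≤product [] [] = ≤-refl
  2^length≤product (_ ∷ xs) (2≤x ∷ 2≤xs) = *-mono-≤ 2≤x (2^length≤product xs 2≤xs)

  length-cartesianProductWith : ∀ {A B C : Set} (f : A → B → C) xs ys →
    length (cartesianProductWith f xs ys) ≡ length xs * length ys
  length-cartesianProductWith f [] ys = refl
  length-cartesianProductWith f (x ∷ xs) ys = trans (length-++ (map (f x) ys))
    (cong₂ _+_ (length-map (f x) ys) (length-cartesianProductWith f xs ys))

  module _ {A B : Set} where

    map-proj₂-zip : ∀ (xs : List A) (ys : List B) → map proj₂ (zip xs ys) ≡ take (length xs) ys
    map-proj₂-zip [] ys = refl
    map-proj₂-zip (x ∷ xs) [] = refl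
    map-proj₂-zip (x ∷ xs) (y ∷ ys) = cong (y ∷_) (map-proj₂-zip xs ys)

    ∈-zip-partner : ∀ {x} {xs : List A} {ys : List B} → x ∈ xs → length xs ≤ length ys → ∃ λ y → (x , y) ∈ zip xs ys
    ∈-zip-partner {xs = _ ∷ _} {y ∷ _} (here refl) _ = y , here refl
    ∈-zip-partner {xs = _ ∷ _} {_ ∷ _} (there x∈xs) (s≤s |xs|≤|ys|) with ∈-zip-partner x∈xs |xs|≤|ys|
    ... | y , xy∈ = y , there xy∈

module Boxes where

  open import Defs
  open import Data.Nat as ℕ using (ℕ; zero; suc; _≤_; _^_; s≤s; z≤n)
  open import Data.Nat.Properties
  open import Data.Nat.Divisibility using (_∣_; _∣0)
  open import Data.Nat.GCD using (gcd-greatest)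
  open import Data.Integer using (ℤ; +_; -[1+_]; ∣_∣)
  open import Data.Fin using (zero; suc)
  open import Data.Vec using (Vec; []; _∷_; lookup)
  open import Data.Vec.Properties using (∷-injective)
  open import Data.List using (List; []; _∷_; _++_; length; map; upTo; cartesianProductWith)
  open import Data.List.Properties using (length-map; length-++; length-upTo)
  open import Data.List.Membership.Propositional using (_∈_)
  open import Data.List.Membership.Propositional.Properties
    using (∈-map⁺; ∈-map⁻; ∈-++⁺ˡ; ∈-++⁺ʳ; ∈-++⁻; ∈-upTo⁺; ∈-upTo⁻; ∈-cartesianProductWith⁺; ∈-cartesianProductWith⁻)
  open import Data.List.Relation.Unary.Any using (here)
  open import Data.Product using (_,_)
  open import Data.Sum using (inj₁; inj₂)
  open import Relation.Binary.PropositionalEquality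
  open Lists

  interval : ℕ → List ℤ
  interval R = map +_ (upTo (suc R)) ++ map -[1+_] (upTo R)

  length-interval : ∀ R → length (interval R) ≡ suc (R ℕ.+ R)
  length-interval R = trans (length-++ (map +_ (upTo (suc R))))
    (cong₂ ℕ._+_ (trans (length-map +_ (upTo (suc R))) (length-upTo (suc R))) (trans (length-map -[1+_] (upTo R)) (length-upTo R)))

  ∈-interval⁺ : ∀ {R} x → ∣ x ∣ ≤ R → x ∈ interval R
  ∈-interval⁺ (+ i) i≤R = ∈-++⁺ˡ (∈-map⁺ +_ (∈-upTo⁺ (s≤s i≤R)))
  ∈-interval⁺ {R} -[1+ i ] i<R = ∈-++⁺ʳ (map +_ (upTo (suc R))) (∈-map⁺ -[1+_] (∈-upTo⁺ i<R))

  ∈-interval⁻ : ∀ {R} x → x ∈ interval R → ∣ x ∣ ≤ R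
  ∈-interval⁻ {R} x x∈ with ∈-++⁻ (map +_ (upTo (suc R))) x∈
  ... | inj₁ x∈⁺ with ∈-map⁻ +_ x∈⁺
  ...   | i , i∈ , refl = ≤-pred (∈-upTo⁻ i∈)
  ∈-interval⁻ x x∈ | inj₂ x∈⁻ with ∈-map⁻ -[1+_] x∈⁻
  ...   | i , i∈ , refl = ∈-upTo⁻ i∈

  box : ∀ n → ℕ → List (Vec ℤ n)
  box zero R = [] ∷ []
  box (suc n) R = cartesianProductWith _∷_ (interval R) (box n R)

  length-box : ∀ n R → length (box n R) ≡ suc (R ℕ.+ R) ^ n
  length-box zero R = refl
  length-box (suc n) R = trans (length-cartesianProductWith _∷_ (interval R) (box n R))
    (cong₂ ℕ._*_ (length-interval R) (length-box n R))

  ∈-box⁺ : ∀ {n R} (h : Vec ℤ n) → height h ≤ R → h ∈ box n R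
  ∈-box⁺ [] _ = here refl
  ∈-box⁺ (x ∷ h) x∷h≤R = ∈-cartesianProductWith⁺ _∷_
    (∈-interval⁺ x (m⊔n≤o⇒m≤o ∣ x ∣ _ x∷h≤R)) (∈-box⁺ h (m⊔n≤o⇒n≤o ∣ x ∣ _ x∷h≤R))

  ∈-box⁻ : ∀ {n R} (h : Vec ℤ n) → h ∈ box n R → height h ≤ R
  ∈-box⁻ [] _ = z≤n
  ∈-box⁻ {suc n} {R} (x ∷ h) x∷h∈ with ∈-cartesianProductWith⁻ _∷_ (interval R) (box n R) x∷h∈
  ... | y , g , y∈ , g∈ , x∷h≡y∷g with ∷-injective x∷h≡y∷g
  ...   | refl , refl = ⊔-lub (∈-interval⁻ x y∈) (∈-box⁻ h g∈)

  ∣lookup∣≤height : ∀ {n} (x : Vec ℤ n) i → ∣ lookup x i ∣ ≤ height x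
  ∣lookup∣≤height (x ∷ xs) zero = m≤m⊔n ∣ x ∣ _
  ∣lookup∣≤height (x ∷ xs) (suc i) = ≤-trans (∣lookup∣≤height xs i) (m≤n⊔m ∣ x ∣ _)

  height≤ : ∀ {n} (x : Vec ℤ n) {B} → (∀ i → ∣ lookup x i ∣ ≤ B) → height x ≤ B
  height≤ [] _ = z≤n
  height≤ (x ∷ xs) bounded = ⊔-lub (bounded zero) (height≤ xs (λ i → bounded (suc i)))

  ∣gcdVec : ∀ {n} (x : Vec ℤ n) {d} → (∀ i → d ∣ ∣ lookup x i ∣) → d ∣ gcdVec x
  ∣gcdVec [] _ = _ ∣0
  ∣gcdVec (x ∷ xs) d∣ = gcd-greatest (d∣ zero) (∣gcdVec xs (λ i → d∣ (suc i)))

module CoprimeShift where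

  open import Defs
  open import Data.Nat using (ℕ; suc; _≤_; _<_; _≟_)
  open import Data.Nat.Properties using (≤-refl; ≤-trans; ≤-reflexive; ≤-antisym; ≮⇒≥; ≰⇒>; anyUpTo?)
  open import Data.Nat.Induction using (<-rec)
  open import Data.Nat.GCD using (gcd; gcd-zeroˡ)
  open import Data.Integer using (ℤ; ∣_∣; _+_; _-_; 0ℤ; 1ℤ)
  open import Data.Integer.Tactic.RingSolver using (solve-∀)
  open import Data.Vec using (Vec; _∷_; replicate)
  open import Data.List.Relation.Unary.Any using (Any; any?)
  open import Data.List.Membership.Propositional using (lose; find)
  open import Data.Product using (∃; _×_; _,_)
  open import Relation.Nullary using (¬_; yes; no)
  open import Relation.Unary using (Decidable)
  open import Relation.Binary.PropositionalEquality
  open Boxes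

  Minimal : (ℕ → Set) → ℕ → Set
  Minimal P m = P m × (∀ {k} → k < m → ¬ P k)

  least : ∀ {P : ℕ → Set} → Decidable P → ∀ {n} → P n → ∃ (Minimal P)
  least {P} P? = <-rec (λ n → P n → ∃ (Minimal P)) go _
    where
    go : ∀ n → (∀ {k} → k < n → P k → ∃ (Minimal P)) → P n → ∃ (Minimal P)
    go n smaller Pn with anyUpTo? P? n
    ... | yes (k , k<n , Pk) = smaller k<n Pk
    ... | no none = n , Pn , λ k<n Pk → none (_ , k<n , Pk)

  HasCoprimeShift : ∀ {n} → Vec ℤ n → ℕ → Set
  HasCoprimeShift {n} a H = Any (λ h → gcdVec (a ⊕ h) ≡ 1) (box n H)

  coprime⇒HasCoprimeShift : ∀ {n} (a h : Vec ℤ n) → gcdVec (a ⊕ h) ≡ 1 → HasCoprimeShift a (height h)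
  coprime⇒HasCoprimeShift a h coprime = lose (∈-box⁺ h ≤-refl) coprime

  coprime-shift : ∀ {n} (a : Vec ℤ (suc n)) → ∃ λ h → gcdVec (a ⊕ h) ≡ 1
  coprime-shift {n} (a₀ ∷ a) = (1ℤ - a₀) ∷ replicate n 0ℤ ,
    trans (cong (λ x → gcd ∣ x ∣ rest) (x+[1-x]≡1 a₀)) (gcd-zeroˡ rest)
    where
    rest : ℕ
    rest = gcdVec (a ⊕ replicate n 0ℤ)
    x+[1-x]≡1 : ∀ x → x + (1ℤ - x) ≡ 1ℤ
    x+[1-x]≡1 = solve-∀

  ℓ-exists : ∀ {n} (a : Vec ℤ (suc n)) → ∃ (IsEll a)
  ℓ-exists a with coprime-shift a
  ... | h₁ , coprime₁ with least (λ H → any? (λ h → gcdVec (a ⊕ h) ≟ 1) (box _ H)) (coprime⇒HasCoprimeShift a h₁ coprime₁)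
  ... | L , hasL , minimal with find hasL
  ... | h , h∈ , coprime = L , (h , height≡L , coprime) , L≤
    where
    L≤ : ∀ g → gcdVec (a ⊕ g) ≡ 1 → L ≤ height g
    L≤ g coprime-g = ≮⇒≥ λ g<L → minimal g<L (coprime⇒HasCoprimeShift a g coprime-g)
    height≡L : height h ≡ L
    height≡L = ≤-antisym (∈-box⁻ h h∈) (L≤ h coprime)

  IsEll⇒< : ∀ {n} {a : Vec ℤ n} {L R} → IsEll a L → (∀ h → height h ≤ R → gcdVec (a ⊕ h) ≢ 1) → R < L
  IsEll⇒< ((h , height≡L , coprime) , _) no-coprime-shift =
    ≰⇒> λ L≤R → no-coprime-shift h (≤-trans (≤-reflexive height≡L) L≤R) coprime

module Construction (n-1 w : ℕ) where

  open import Defs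
  open import Data.Nat as ℕ using (suc; _≤_; _<_; _^_; NonZero; s≤s; z≤n; nonTrivial⇒n>1; >-nonZero)
  open import Data.Nat.Properties
  open import Data.Nat.Divisibility as ℕ using () renaming (_∣_ to _∣ₙ_)
  open import Data.Nat.Logarithm using (⌊log₂_⌋)
  open import Data.Nat.Primality using (Prime; prime⇒nonTrivial)
  open import Data.Nat.ListAction using (product)
  open import Data.Nat.ListAction.Properties using (∈⇒∣product)
  open import Data.Nat.Tactic.RingSolver as ℕ-Solver using ()
  open import Data.Integer as ℤ using (ℤ; +_; ∣_∣; _%ℕ_)
  open import Data.Integer.DivMod using (n%ℕd<d)
  open import Data.Integer.Divisibility.Signed as ℤ using (∣ᵤ⇒∣; ∣⇒∣ᵤ; ∣m∣n⇒∣m+n)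
  open import Data.Integer.Tactic.RingSolver using (solve-∀)
  open import Data.Fin using (Fin; zero)
  open import Data.Vec using (Vec; lookup; tabulate)
  open import Data.Vec.Properties using (lookup-zipWith; lookup∘tabulate)
  open import Data.List using (List; length; map; zip; take)
  open import Data.List.Properties using (length-take)
  open import Data.List.Membership.Propositional using (_∈_)
  open import Data.List.Membership.Propositional.Properties using (∈-map⁺)
  open import Data.List.Relation.Unary.All as All using (All)
  import Data.List.Relation.Unary.All.Properties as All
  open import Data.List.Relation.Unary.Unique.Propositional using (Unique)
  import Data.List.Relation.Unary.Unique.Propositional.Properties as Unique
  open import Data.Product using (∃; _×_; _,_; proj₁; proj₂)
  open import Relation.Binary.PropositionalEquality
  open Arithmetic
  open PrimeCounting
  open ChineseRemainder
  open Boxes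
  open Lists
  open CoprimeShift

  n R T u X : ℕ
  n = suc n-1
  R = 2 ^ w
  T = suc w ℕ.* n
  u = 3 ℕ.+ (n ℕ.+ T)
  X = 2 ^ suc (u ℕ.+ u)

  shifts : List (Vec ℤ n)
  shifts = box n R

  m : ℕ
  m = length shifts

  primes : List ℕ
  primes = primesUpTo X

  m≡ : m ≡ suc (R ℕ.+ R) ^ n
  m≡ = length-box n R

  2^T≤m : 2 ^ T ≤ m
  2^T≤m = begin
    2 ^ T                   ≡⟨ ^-*-assoc 2 (suc w) n ⟨
    (R ℕ.+ (R ℕ.+ 0)) ^ n   ≤⟨ ^-monoˡ-≤ n (≤-trans (≤-reflexive (cong (R ℕ.+_) (+-identityʳ R))) (n≤1+n _)) ⟩
    suc (R ℕ.+ R) ^ n       ≡⟨ m≡ ⟨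
    m                       ∎
    where open ≤-Reasoning

  m≤|primes| : m ≤ length primes
  m≤|primes| = begin
    m                             ≡⟨ m≡ ⟩
    suc (R ℕ.+ R) ^ n             ≤⟨ ^-monoˡ-≤ n (+-monoˡ-≤ (R ℕ.+ R) (≤-trans (m^n>0 2 w) (m≤m+n R R))) ⟩
    (R ℕ.+ R ℕ.+ (R ℕ.+ R)) ^ n   ≡⟨ cong (_^ n) (4R≡ R) ⟨
    (2 ^ suc (suc w)) ^ n         ≡⟨ ^-*-assoc 2 (suc (suc w)) n ⟩
    2 ^ (n ℕ.+ T)                 ≤⟨ ^-monoʳ-≤ 2 (m≤n+m (n ℕ.+ T) 3) ⟩
    2 ^ u                         ≤⟨ 2^u≤π[2^[1+2u]] u (s≤s (s≤s (s≤s z≤n))) ⟩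
    length primes                 ∎
    where
    open ≤-Reasoning
    4R≡ : ∀ R → 2 ℕ.* (2 ℕ.* R) ≡ R ℕ.+ R ℕ.+ (R ℕ.+ R)
    4R≡ = ℕ-Solver.solve-∀

  moduli : List (Vec ℤ n × ℕ)
  moduli = zip shifts primes

  ps : List ℕ
  ps = map proj₂ moduli

  ps≡ : ps ≡ take m primes
  ps≡ = map-proj₂-zip shifts primes

  ps-prime : All Prime ps
  ps-prime = subst (All Prime) (sym ps≡) (All.take⁺ m (primesUpTo-prime X))

  ps-unique : Unique ps
  ps-unique = subst Unique (sym ps≡) (Unique.take⁺ m (primesUpTo-unique X))

  length-ps : length ps ≡ m
  length-ps = trans (cong length ps≡) (trans (length-take m primes) (m≤n⇒m⊓n≡m m≤|primes|))

  M : ℕ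
  M = product ps

  2^m≤M : 2 ^ m ≤ M
  2^m≤M = subst (λ l → 2 ^ l ≤ M) length-ps
    (2^length≤product ps (All.map (λ q-prime → nonTrivial⇒n>1 _ {{prime⇒nonTrivial q-prime}}) ps-prime))

  M≤X^m : M ≤ X ^ m
  M≤X^m = subst (λ l → M ≤ X ^ l) length-ps
    (product≤^length ps (subst (All (_≤ X)) (sym ps≡) (All.take⁺ m (primesUpTo-≤ X))))

  instance
    M≢0 : NonZero M
    M≢0 = >-nonZero (≤-trans (m^n>0 2 m) 2^m≤M)

  y : Fin n → ℤ
  y j = proj₁ (chineseRemainder (λ h → ℤ.- lookup h j) moduli ps-prime ps-unique)

  a : Vec ℤ n
  a = tabulate λ j → + (y j %ℕ M ℕ.+ M)

  lookup-a : ∀ j → lookup a j ≡ + (y j %ℕ M ℕ.+ M)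
  lookup-a = lookup∘tabulate _

  p∣a+h : ∀ {h p} → (h , p) ∈ moduli → ∀ j → p ∣ₙ ∣ lookup (a ⊕ h) j ∣
  p∣a+h {h} {p} hp∈ j = ∣⇒∣ᵤ (subst (+ p ℤ.∣_) (sym a+h≡) (∣m∣n⇒∣m+n p∣a-y p∣y+h))
    where
    A+H≡[A-Y]+[Y+H] : ∀ A Y H → A ℤ.+ H ≡ (A ℤ.- Y) ℤ.+ (Y ℤ.- ℤ.- H)
    A+H≡[A-Y]+[Y+H] = solve-∀
    a+h≡ : lookup (a ⊕ h) j ≡ (lookup a j ℤ.- y j) ℤ.+ (y j ℤ.- ℤ.- lookup h j)
    a+h≡ = trans (lookup-zipWith ℤ._+_ j a h) (A+H≡[A-Y]+[Y+H] (lookup a j) (y j) (lookup h j))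
    p∣a-y : + p ℤ.∣ lookup a j ℤ.- y j
    p∣a-y = ℤ.∣-trans (∣ᵤ⇒∣ (∈⇒∣product (∈-map⁺ proj₂ hp∈)))
      (subst (λ t → + M ℤ.∣ t ℤ.- y j) (sym (lookup-a j)) (M∣[y%M+M]-y (y j) M))
    p∣y+h : + p ℤ.∣ y j ℤ.- ℤ.- lookup h j
    p∣y+h = All.lookup (proj₂ (chineseRemainder (λ h → ℤ.- lookup h j) moduli ps-prime ps-unique)) hp∈

  no-coprime-shift : ∀ h → height h ≤ R → gcdVec (a ⊕ h) ≢ 1
  no-coprime-shift h h≤R coprime with ∈-zip-partner (∈-box⁺ h h≤R) m≤|primes|
  ... | p , hp∈ = <⇒≢ 1<p (sym (ℕ.∣1⇒≡1 (subst (p ∣ₙ_) coprime (∣gcdVec (a ⊕ h) (p∣a+h hp∈)))))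
    where
    1<p : 1 < p
    1<p = nonTrivial⇒n>1 p {{prime⇒nonTrivial (All.lookup ps-prime (∈-map⁺ proj₂ hp∈))}}

  M≤height : M ≤ height a
  M≤height = ≤-trans (m≤n+m M (y zero %ℕ M)) (subst (λ t → ∣ t ∣ ≤ height a) (lookup-a zero) (∣lookup∣≤height a zero))

  height≤2M : height a ≤ M ℕ.+ M
  height≤2M = height≤ a λ j → subst (λ t → ∣ t ∣ ≤ M ℕ.+ M) (sym (lookup-a j)) (+-monoˡ-≤ M (<⇒≤ (n%ℕd<d (y j) M)))

  ℓ : ∃ (IsEll a)
  ℓ = ℓ-exists a

  L : ℕ
  L = proj₁ ℓ

  isEll : IsEll a L
  isEll = proj₂ ℓ

  R<L : R < L
  R<L = IsEll⇒< {a = a} isEll no-coprime-shift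

  m≤2^n*L^n : m ≤ 2 ^ n ℕ.* L ^ n
  m≤2^n*L^n = begin
    m                    ≡⟨ m≡ ⟩
    suc (R ℕ.+ R) ^ n    ≤⟨ ^-monoˡ-≤ n (+-mono-≤ R<L (≤-trans (<⇒≤ R<L) (≤-reflexive (sym (+-identityʳ L))))) ⟩
    (2 ℕ.* L) ^ n        ≡⟨ [m*n]^o≡m^o*n^o 2 L n ⟩
    2 ^ n ℕ.* L ^ n      ∎
    where open ≤-Reasoning

  1≤T : 1 ≤ T
  1≤T = ≤-trans (s≤s z≤n) (m≤m*n (suc w) n)

  w≤height : w ≤ height a
  w≤height = begin
    w       ≤⟨ ≤-trans (n≤1+n w) (m≤m*n (suc w) n) ⟩
    T       ≤⟨ <⇒≤ (n<2^n T) ⟩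
    2 ^ T   ≤⟨ 2^T≤m ⟩
    m       ≤⟨ <⇒≤ (n<2^n m) ⟩
    2 ^ m   ≤⟨ 2^m≤M ⟩
    M       ≤⟨ M≤height ⟩
    height a ∎
    where open ≤-Reasoning

  c : ℕ
  c = suc (suc (u ℕ.+ u))

  c≤12T : c ≤ 12 ℕ.* T
  c≤12T = begin
    c                                       ≡⟨ c≡ n T ⟩
    8 ℕ.+ (n ℕ.+ n) ℕ.+ (T ℕ.+ T)           ≤⟨ +-monoˡ-≤ (T ℕ.+ T) (+-mono-≤ (*-monoʳ-≤ 8 1≤T) (+-mono-≤ n≤T n≤T)) ⟩
    8 ℕ.* T ℕ.+ (T ℕ.+ T) ℕ.+ (T ℕ.+ T)     ≡⟨ 12T≡ T ⟩
    12 ℕ.* T                                ∎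
    where
    open ≤-Reasoning
    n≤T : n ≤ T
    n≤T = m≤n*m n (suc w)
    c≡ : ∀ n T → suc (suc ((3 ℕ.+ (n ℕ.+ T)) ℕ.+ (3 ℕ.+ (n ℕ.+ T)))) ≡ 8 ℕ.+ (n ℕ.+ n) ℕ.+ (T ℕ.+ T)
    c≡ = ℕ-Solver.solve-∀
    12T≡ : ∀ T → 8 ℕ.* T ℕ.+ (T ℕ.+ T) ℕ.+ (T ℕ.+ T) ≡ 12 ℕ.* T
    12T≡ = ℕ-Solver.solve-∀

  height≤2^cm : height a ≤ 2 ^ (c ℕ.* m)
  height≤2^cm = begin
    height a                    ≤⟨ height≤2M ⟩
    M ℕ.+ M                     ≤⟨ +-mono-≤ M≤X^m M≤X^m ⟩
    X ^ m ℕ.+ X ^ m             ≡⟨ cong (λ t → t ℕ.+ t) (^-*-assoc 2 (suc (u ℕ.+ u)) m) ⟩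
    2 ^ e ℕ.+ 2 ^ e             ≡⟨ cong (2 ^ e ℕ.+_) (+-identityʳ (2 ^ e)) ⟨
    2 ^ suc e                   ≤⟨ ^-monoʳ-≤ 2 (+-monoˡ-≤ e (≤-trans (m^n>0 2 T) 2^T≤m)) ⟩
    2 ^ (c ℕ.* m)               ∎
    where
    open ≤-Reasoning
    e : ℕ
    e = suc (u ℕ.+ u) ℕ.* m

  log₂-height-bound : ⌊log₂ height a ⌋ ≤ (12 ℕ.* 2 ^ n) ℕ.* L ^ n ℕ.* ⌊log₂ ⌊log₂ height a ⌋ ⌋
  log₂-height-bound = begin
    ⌊log₂ height a ⌋                           ≤⟨ log₂-ratio c≤12T 2^T≤m (≤-trans 2^m≤M M≤height) height≤2^cm ⟩
    12 ℕ.* m ℕ.* ll                            ≤⟨ *-monoˡ-≤ ll (*-monoʳ-≤ 12 m≤2^n*L^n) ⟩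
    12 ℕ.* (2 ^ n ℕ.* L ^ n) ℕ.* ll            ≡⟨ cong (ℕ._* ll) (*-assoc 12 (2 ^ n) (L ^ n)) ⟨
    (12 ℕ.* 2 ^ n) ℕ.* L ^ n ℕ.* ll            ∎
    where
    open ≤-Reasoning
    ll : ℕ
    ll = ⌊log₂ ⌊log₂ height a ⌋ ⌋

open import Defs
open import Data.Nat using (ℕ; suc; _≤_; _*_; _^_; s≤s; z≤n)
open import Data.Nat.Properties using (*-mono-≤; m^n>0)
open import Data.Nat.Logarithm using (⌊log₂_⌋)
open import Data.Integer using (ℤ)
open import Data.Vec using (Vec)
open import Data.Product using (Σ; _×_; _,_)

theorem3 : (n : ℕ) → 1 ≤ n →
    Σ ℕ (λ K → 1 ≤ K ×
      ((B : ℕ) → Σ (Vec ℤ n) (λ a → Σ ℕ (λ L →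
        B ≤ height a × IsEll a L ×
        ⌊log₂ height a ⌋ ≤ K * (L ^ n) * ⌊log₂ ⌊log₂ height a ⌋ ⌋))))
theorem3 (suc n-1) _ = 12 * 2 ^ suc n-1 , *-mono-≤ {1} {12} (s≤s z≤n) (m^n>0 2 (suc n-1)) , λ B →
  let open Construction n-1 B in a , L , w≤height , isEll , log₂-height-bound
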